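{- Fix a finite set of atoms $A$ and a freshness context $\nabla$ (the global parameters of the algorithm $\mathsf{VNAU}$ described in the context). Let $P;\,S;\,\Gamma;\,\sigma$ be an arbitrary state, with $P$ and $S$ finite. Then there are only finitely many possible $\mathsf{VNAU}$ rule applications $P;\,S;\,\Gamma;\,\sigma \Longrightarrow P_i;\,S_i;\,\Gamma_i;\,\sigma_i$, $1\le i\le n$, and for every $1\le i\le n$ we have $\mu(P;\,S;\,\Gamma;\,\sigma) > \mu(P_i;\,S_i;\,\Gamma_i;\,\sigma_i)$, where $\mu$ is the measure defined in the context and $>$ is the lexicographic ordering on $\mathbb{N}^5$.
   Context: Signature: four pairwise disjoint sets: a countably infinite set of atoms $\mathbf{A}=\{a,b,c,\dots\}$, a countable set of variadic function symbols $\{f,g,h,\dots\}$, a countably infinite set of individual variables $\{x,y,z,\dots\}$ and a countably infinite set of hedge variables $\{X,Y,Z,\dots\}$; $\chi$ denotes a variable of either kind. Permutations $\pi$ of atoms have finite support $\mathrm{supp}(\pi)=\{a\mid \pi(a)\neq a\}$ and are written as finite sequences of swappings $(a\,b)$; $\mathit{Id}$ is the identity. Terms are individual terms $t::= a \mid \pi\cdot x \mid a.t \mid f(\tilde s)$, and hedges $\tilde s ::= r_1,\dots,r_n$ ($n\ge 0$) with $r::=\pi\cdot X\mid t$. Hedges are flat (nested sequences are concatenated), a singleton hedge is identified with its element, $\varepsilon$ is the empty hedge, $|\tilde s|$ is the length, $\tilde s|_i$ the $i$-th element. $\pi\cdot x$, $\pi\cdot X$ are suspensions; $\chi$ abbreviates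 $\mathit{Id}\cdot\chi$. Permutations act on terms: $(a\,b)\cdot a=b$, $(a\,b)\cdot b=a$, $(a\,b)\cdot c=c$ for $c\notin\{a,b\}$, $(a\,b)\cdot(\pi\cdot\chi)=((a\,b)\pi)\cdot\chi$, $(a\,b)\cdot(c.t)=((a\,b)\cdot c).((a\,b)\cdot t)$, $(a\,b)\cdot f(\tilde s)=f((a\,b)\cdot\tilde s)$, componentwise on hedges, and a sequence of swappings acts from right to left. The head of an individual term or hedge suspension is $\mathrm{head}(a)=a$, $\mathrm{head}(\pi\cdot\chi)=\chi$, $\mathrm{head}(a.t)=\text{``.''}$, $\mathrm{head}(f(\tilde s))=f$. Substitutions are finite maps from variables to terms (individual variables to individual terms), identity elsewhere; $id$ is the empty substitution; application: $a\sigma=a$, $(\pi\cdot\chi)\sigma=\pi\cdot(\chi\sigma)$, $(a.t)\sigma=a.(t\sigma)$, $f(\tilde s)\sigma=f(\tilde s\sigma)$, componentwise on hedges. $\sigma\{\chi\mapsto u\}$ denotes the composition of $\sigma$ followed by $\{\chi\mapsto u\}$. A freshness context is a finite set of constraints $a\#\chi$. The judgement $\nabla\vdash a\# u$ is defined by: $\nabla\vdash a\#b$ if $a\ne b$; $\nabla\vdash a\#f(\tilde s)$ if $\nabla\vdash a\#\tilde s$; $\nabla\vdash a\#(r_1,\dots,r_n)$ if $\nabla\vdash a\#r_i$ for all $i$; $\nabla\vdash a\#a.t$; $\nabla\vdash a\#b.t$ if $a\neq b$ and $\nabla\vdash a\#t$; $\nabla\vdash a\#\pi\cdot\chi$ if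 $(\pi^{ -1}\cdot a)\#\chi\in\nabla$. Applying a substitution to a freshness context, $\Gamma\{\chi\mapsto u\}$, means replacing $\Gamma$ by the smallest freshness context $\Gamma'$ such that $\Gamma'\vdash a\#\chi'\{\chi\mapsto u\}$ for all $a\#\chi'\in\Gamma$. The equivalence $\nabla\vdash u\approx u'$ (equality up to renaming of bound atoms) is given by: $a\approx a$; $f(\tilde s)\approx f(\tilde q)$ if $\tilde s\approx\tilde q$; hedges of equal length componentwise; $a.t\approx a.t'$ if $t\approx t'$; $a.t\approx b.t'$ if $t\approx (a\,b)\cdot t'$ and $\nabla\vdash a\#b.t'$; $\pi\cdot\chi\approx\pi'\cdot\chi$ if $a\#\chi\in\nabla$ for all $a$ with $\pi\cdot a\neq\pi'\cdot a$. $A$-based means all atoms occurring (including in supports of permutations) lie in $A$. The algorithm $\mathsf{VNAU}$ (global parameters: finite $A\subset\mathbf{A}$ and freshness context $\nabla$) works on states $P;\,S;\,\Gamma;\,\sigma$ where $P$ (problems) and $S$ (store) are sets of anti-unification problems (AUPs) $\chi\colon \ell\triangleq r$ ($\chi$ a variable, $\ell,r$ terms or hedges), $\Gamma$ a freshness context, $\sigma$ a substitution. "New" variables occur neither in the state nor in the parameters; $\dot\cup$ is disjoint union. Rules: (Tri-T) $\{X\colon a\triangleq a\}\dot\cup P;S;\Gamma;\sigma \Rightarrow P;S;\Gamma;\sigma\{X\mapsto a\}$. (Tri-H) $\{X\colon \varepsilon\triangleq\varepsilon\}\dot\cup P;S;\Gamma;\sigma\Rightarrow P;S;\Gamma;\sigma\{X\mapsto\varepsilon\}$.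 (Dec-T) $\{X\colon f(\tilde s)\triangleq f(\tilde q)\}\dot\cup P;S;\Gamma;\sigma\Rightarrow\{Y\colon\tilde s\triangleq\tilde q\}\cup P;S;\Gamma;\sigma\{X\mapsto f(Y)\}$, $Y$ a new hedge variable. (Dec-H) $\{X\colon \tilde s_1,\tilde s_2\triangleq\tilde q_1,\tilde q_2\}\dot\cup P;S;\Gamma;\sigma\Rightarrow\{Y_1\colon\tilde s_1\triangleq\tilde q_1, Y_2\colon\tilde s_2\triangleq\tilde q_2\}\cup P;S;\Gamma;\sigma\{X\mapsto Y_1,Y_2\}$, where $|\tilde s_1,\tilde q_1|=1$ or $|\tilde s_1|=|\tilde q_1|=1$, $|\tilde s_2,\tilde q_2|\ge 1$, and $Y_1,Y_2$ are new hedge variables. (Abs-T) $\{X\colon a.t_1\triangleq b.t_2\}\dot\cup P;S;\Gamma;\sigma\Rightarrow\{Y\colon (c\,a)\cdot t_1\triangleq (c\,b)\cdot t_2\}\cup P;S;\Gamma;\sigma\{X\mapsto c.Y\}$, where $c\in A$, $Y$ a new hedge variable, $\nabla\vdash c\#a.t_1$ and $\nabla\vdash c\#b.t_2$. (Sol-T) $\{X\colon r_1\triangleq r_2\}\dot\cup P;S;\Gamma;\sigma\Rightarrow P;\{X\colon r_1\triangleq r_2\}\cup S;\{a\#X\mid a\in A,\nabla\vdash a\#r_1,\nabla\vdash a\#r_2\}\cup\Gamma;\sigma$, where $r_1,r_2$ are suspensions or $\mathrm{head}(r_1)\ne\mathrm{head}(r_2)$. (Sol-H) $\{X\colon \tilde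 s\triangleq\tilde q\}\dot\cup P;S;\Gamma;\sigma\Rightarrow P;\{X\colon\tilde s\triangleq\tilde q\}\cup S;\{a\#X\mid a\in A,\nabla\vdash a\#\tilde s,\nabla\vdash a\#\tilde q\}\cup\Gamma;\sigma$, where $|\tilde s,\tilde q|=1$. (Mer) $P;\{\chi_1\colon\ell_1\triangleq r_1,\chi_2\colon\ell_2\triangleq r_2\}\dot\cup S;\Gamma;\sigma\Rightarrow P;\{\chi_1\colon\ell_1\triangleq r_1\}\cup S;\Gamma\{\chi_2\mapsto\pi\cdot\chi_1\};\sigma\{\chi_2\mapsto\pi\cdot\chi_1\}$, where $\pi$ is an $A$-based permutation with $\nabla\vdash\pi\cdot\ell_1\approx\ell_2$ and $\nabla\vdash\pi\cdot r_1\approx r_2$. (Nar-T) $P;\{X\colon t_1\triangleq t_2\}\dot\cup S;\Gamma;\sigma\Rightarrow P;\{x\colon t_1\triangleq t_2\}\cup S;\Gamma\{X\mapsto x\};\sigma\{X\mapsto x\}$ ($t_1,t_2$ individual terms, $x$ new individual variable). The measure $\mu(P;S;\Gamma;\sigma)\in\mathbb{N}^5$ has components: (1) the total number of function-symbol occurrences and abstraction occurrences in all AUPs of $P$; (2) $\sum_{X\colon\tilde s\triangleq\tilde q\in P}|\tilde s,\tilde q|^2$; (3) the number of AUPs in $P$; (4) the number of AUPs in $S$; (5) the total number of hedge-variable occurrences in all AUPs of $S$. Measures are compared lexicographically. -}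

module Defs where

open import Data.Nat using (ℕ; zero; suc; _+_; _*_; _<_; _≡ᵇ_)
open import Data.Bool using (Bool; true; false; if_then_else_; _∧_)
open import Data.List using (List; []; _∷_; _++_; length; map)
open import Data.List.Membership.Propositional using (_∈_; _∉_)
open import Data.Product using (Σ; ∃; _×_; _,_)
open import Data.Sum using (_⊎_)
open import Data.Vec using (Vec)
import Data.Vec as V
open import Data.Vec.Relation.Binary.Lex.Strict using (Lex-<)
open import Relation.Binary.PropositionalEquality using (_≡_; _≢_)
open import Relation.Nullary using (¬_)

Atom : Set
Atom = ℕ

FunSym : Set
FunSym = ℕ

data Var : Set where
  ivar : ℕ → Var
  hvar : ℕ → Var

varEq : Var → Var → Bool
varEq (ivar m) (ivar n) = m ≡ᵇ n
varEq (hvar m) (hvar n) = m ≡ᵇ n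
varEq _ _ = false

-- Permutations: finite sequences of swappings (a b), acting right to left.

Perm : Set
Perm = List (Atom × Atom)

swap : Atom × Atom → Atom → Atom
swap (a , b) c = if c ≡ᵇ a then b else (if c ≡ᵇ b then a else c)

act : Perm → Atom → Atom
act []      c = c
act (s ∷ π) c = swap s (act π c)

actInv : Perm → Atom → Atom
actInv []      c = c
actInv (s ∷ π) c = actInv π (swap s c)

-- Term : individual terms  t ::= a | π·x | a.t | f(s̃)
--   Elem : hedge elements    r ::= π·X | t
--   Hedge: flat sequences r₁,…,rₙ (a singleton hedge is identified with
--          its element; a term t is the hedge  ind t ∷ []).

mutual
  data Term : Set where
    atom : Atom → Term
    isusp : Perm → ℕ → Term
    abs  : Atom → Elem → Term
    fun  : FunSym → Hedge → Term

  data Elem : Set where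
    hsusp : Perm → ℕ → Elem
    ind   : Term → Elem

  Hedge : Set
  Hedge = List Elem

mutual
  permT : Perm → Term → Term
  permT π (atom a)     = atom (act π a)
  permT π (isusp π' x) = isusp (π ++ π') x
  permT π (abs a t)    = abs (act π a) (permE π t)
  permT π (fun f s)    = fun f (permH π s)

  permE : Perm → Elem → Elem
  permE π (hsusp π' X) = hsusp (π ++ π') X
  permE π (ind t)      = ind (permT π t)

  permH : Perm → Hedge → Hedge
  permH π []      = []
  permH π (r ∷ s) = permE π r ∷ permH π s

data Head : Set where
  hAtom : Atom → Head
  hVar  : Var → Head
  hDot  : Head
  hFun  : FunSym → Head

headE : Elem → Head
headE (hsusp π X)       = hVar (hvar X)
headE (ind (atom a))    = hAtom a
headE (ind (isusp π x)) = hVar (ivar x)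
headE (ind (abs a t))   = hDot
headE (ind (fun f s))   = hFun f

data IsSusp : Elem → Set where
  susp-h : ∀ {π X} → IsSusp (hsusp π X)
  susp-i : ∀ {π x} → IsSusp (ind (isusp π x))

FreshCtx : Set
FreshCtx = List (Atom × Var)

module Freshness (∇ : FreshCtx) where
  mutual
    data FreshT (a : Atom) : Term → Set where
      fr-atom  : ∀ {b} → a ≢ b → FreshT a (atom b)
      fr-susp  : ∀ {π x} → (actInv π a , ivar x) ∈ ∇ → FreshT a (isusp π x)
      fr-abs≡  : ∀ {t} → FreshT a (abs a t)
      fr-abs   : ∀ {b t} → a ≢ b → FreshE a t → FreshT a (abs b t)
      fr-fun   : ∀ {f s} → FreshH a s → FreshT a (fun f s)

    data FreshE (a : Atom) : Elem → Set where
      fr-hsusp : ∀ {π X} → (actInv π a , hvar X) ∈ ∇ → FreshE a (hsusp π X)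
      fr-ind   : ∀ {t} → FreshT a t → FreshE a (ind t)

    data FreshH (a : Atom) : Hedge → Set where
      fr-[] : FreshH a []
      fr-∷  : ∀ {r s} → FreshE a r → FreshH a s → FreshH a (r ∷ s)

  mutual
    data _≈T_ : Term → Term → Set where
      ≈-atom  : ∀ {a} → atom a ≈T atom a
      ≈-fun   : ∀ {f s q} → s ≈H q → fun f s ≈T fun f q
      ≈-abs≡  : ∀ {a t t'} → t ≈E t' → abs a t ≈T abs a t'
      ≈-abs   : ∀ {a b t t'} → t ≈E permE ((a , b) ∷ []) t'
                → FreshT a (abs b t') → abs a t ≈T abs b t'
      ≈-susp  : ∀ {π π' x}
                → (∀ a → act π a ≢ act π' a → (a , ivar x) ∈ ∇)
                → isusp π x ≈T isusp π' x

    data _≈E_ : Elem → Elem → Set where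
      ≈-hsusp : ∀ {π π' X}
                → (∀ a → act π a ≢ act π' a → (a , hvar X) ∈ ∇)
                → hsusp π X ≈E hsusp π' X
      ≈-ind   : ∀ {t t'} → t ≈T t' → ind t ≈E ind t'

    data _≈H_ : Hedge → Hedge → Set where
      ≈-[] : [] ≈H []
      ≈-∷  : ∀ {r r' s s'} → r ≈E r' → s ≈H s' → (r ∷ s) ≈H (r' ∷ s')

-- Substitutions: finite maps, represented by the sequence of elementary
-- bindings composed so far; σ{χ ↦ u} = σ ++ [(χ , u)].
-- (A binding for an individual variable always has a singleton hedge
-- consisting of an individual term.)

Subst : Set
Subst = List (Var × Hedge)

_⟨_↦_⟩ : Subst → Var → Hedge → Subst
σ ⟨ χ ↦ u ⟩ = σ ++ ((χ , u) ∷ [])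

-- Γ{χ ↦ π·χ'}: the smallest freshness context Γ' with Γ' ⊢ a#χ''{χ↦π·χ'}
-- for all a#χ'' ∈ Γ; a#χ becomes (π⁻¹·a)#χ', other constraints stay.
renameCtx : FreshCtx → Var → Perm → Var → FreshCtx
renameCtx Γ χ π χ' = map f Γ
  where
  f : Atom × Var → Atom × Var
  f (a , v) = if varEq v χ then (actInv π a , χ') else (a , v)

suspOf : Perm → Var → Hedge
suspOf π (ivar x) = ind (isusp π x) ∷ []
suspOf π (hvar X) = hsusp π X ∷ []

infix 4 _∶_≜_

record AUP : Set where
  constructor _∶_≜_
  field
    var : Var
    lhs : Hedge
    rhs : Hedge

record State : Set where
  constructor ⟪_,_,_,_⟫
  field
    P : List AUP
    S : List AUP
    Γ : FreshCtx
    σ : Subst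

mutual
  data OccT (χ : Var) : Term → Set where
    o-isusp : ∀ {π x} → χ ≡ ivar x → OccT χ (isusp π x)
    o-abs   : ∀ {a t} → OccE χ t → OccT χ (abs a t)
    o-fun   : ∀ {f s} → OccH χ s → OccT χ (fun f s)

  data OccE (χ : Var) : Elem → Set where
    o-hsusp : ∀ {π X} → χ ≡ hvar X → OccE χ (hsusp π X)
    o-ind   : ∀ {t} → OccT χ t → OccE χ (ind t)

  data OccH (χ : Var) : Hedge → Set where
    o-here  : ∀ {r s} → OccE χ r → OccH χ (r ∷ s)
    o-there : ∀ {r s} → OccH χ s → OccH χ (r ∷ s)

OccAUP : Var → AUP → Set
OccAUP χ (v ∶ l ≜ r) = χ ≡ v ⊎ OccH χ l ⊎ OccH χ r

OccState : Var → State → Set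
OccState χ ⟪ P , S , Γ , σ ⟫ =
  (∃ λ e → e ∈ P × OccAUP χ e) ⊎
  (∃ λ e → e ∈ S × OccAUP χ e) ⊎
  (∃ λ a → (a , χ) ∈ Γ) ⊎
  (∃ λ u → (χ , u) ∈ σ) ⊎
  (∃ λ b → b ∈ σ × OccH χ (Data.Product.proj₂ b))
  where import Data.Product

-- χ is new: occurs neither in the state nor in the parameters (A, ∇);
-- A consists of atoms only, so only ∇ matters among the parameters.
New : FreshCtx → State → Var → Set
New ∇ st χ = ¬ OccState χ st × ¬ (∃ λ a → (a , χ) ∈ ∇)

-- Pick i L x R : x is the i-th element (from 0) of L and R is L with it removed
data Pick {C : Set} : ℕ → List C → C → List C → Set where
  pk-here  : ∀ {x L} → Pick zero (x ∷ L) x L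
  pk-there : ∀ {i x y L R} → Pick i L x R → Pick (suc i) (y ∷ L) x (y ∷ R)

data Ins {C : Set} (x : C) (L : List C) : List C → Set where
  ins-old : x ∈ L → Ins x L L
  ins-new : x ∉ L → Ins x L (x ∷ L)

_Lists_ : {C : Set} → List C → (C → Set) → Set
L Lists Q = ∀ e → (e ∈ L → Q e) × (Q e → e ∈ L)

-- A rule application is labelled by the data that
-- determine it up to the choice of names of new variables and the
-- order in which set elements are listed:
--  the rule, the position(s) of the selected AUP(s), the split (Dec-H),
--  the atom c (Abs-T), and the A-based permutation π, which is determined
--  by its values on A (Mer).

data Label : Set where
  lTriT lTriH lDecT lSolT lSolH lNarT : ℕ → Label
  lDecH : ℕ → ℕ → ℕ → Label
  lAbsT : ℕ → Atom → Label
  lMer  : ℕ → ℕ → List Atom → Label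

module VNAU (A : List Atom) (∇ : FreshCtx) where
  open Freshness ∇

  ABased : Perm → Set
  ABased π = ∀ a → act π a ≢ a → a ∈ A

  data Step : State → Label → State → Set where
    Tri-T : ∀ {i P P' S Γ σ X a}
      → Pick i P (hvar X ∶ ind (atom a) ∷ [] ≜ ind (atom a) ∷ []) P'
      → Step ⟪ P , S , Γ , σ ⟫ (lTriT i)
             ⟪ P' , S , Γ , σ ⟨ hvar X ↦ ind (atom a) ∷ [] ⟩ ⟫
    Tri-H : ∀ {i P P' S Γ σ X}
      → Pick i P (hvar X ∶ [] ≜ []) P'
      → Step ⟪ P , S , Γ , σ ⟫ (lTriH i)
             ⟪ P' , S , Γ , σ ⟨ hvar X ↦ [] ⟩ ⟫
    Dec-T : ∀ {i P P' S Γ σ X f s q Y}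
      → Pick i P (hvar X ∶ ind (fun f s) ∷ [] ≜ ind (fun f q) ∷ []) P'
      → New ∇ ⟪ P , S , Γ , σ ⟫ (hvar Y)
      → Step ⟪ P , S , Γ , σ ⟫ (lDecT i)
             ⟪ (hvar Y ∶ s ≜ q) ∷ P' , S , Γ
             , σ ⟨ hvar X ↦ ind (fun f (hsusp [] Y ∷ [])) ∷ [] ⟩ ⟫
    Dec-H : ∀ {i P P' S Γ σ X s₁ s₂ q₁ q₂ Y₁ Y₂}
      → Pick i P (hvar X ∶ s₁ ++ s₂ ≜ q₁ ++ q₂) P'
      → (length (s₁ ++ q₁) ≡ 1 ⊎ (length s₁ ≡ 1 × length q₁ ≡ 1))
      → 1 Data.Nat.≤ length (s₂ ++ q₂)
      → New ∇ ⟪ P , S , Γ , σ ⟫ (hvar Y₁)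
      → New ∇ ⟪ P , S , Γ , σ ⟫ (hvar Y₂)
      → Y₁ ≢ Y₂
      → Step ⟪ P , S , Γ , σ ⟫ (lDecH i (length s₁) (length q₁))
             ⟪ (hvar Y₁ ∶ s₁ ≜ q₁) ∷ (hvar Y₂ ∶ s₂ ≜ q₂) ∷ P' , S , Γ
             , σ ⟨ hvar X ↦ hsusp [] Y₁ ∷ hsusp [] Y₂ ∷ [] ⟩ ⟫
    Abs-T : ∀ {i P P' S Γ σ X a b c t₁ t₂ Y}
      → Pick i P (hvar X ∶ ind (abs a t₁) ∷ [] ≜ ind (abs b t₂) ∷ []) P'
      → c ∈ A
      → New ∇ ⟪ P , S , Γ , σ ⟫ (hvar Y)
      → FreshT c (abs a t₁)
      → FreshT c (abs b t₂)
      → Step ⟪ P , S , Γ , σ ⟫ (lAbsT i c)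
             ⟪ (hvar Y ∶ permE ((c , a) ∷ []) t₁ ∷ []
                       ≜ permE ((c , b) ∷ []) t₂ ∷ []) ∷ P'
             , S , Γ , σ ⟨ hvar X ↦ ind (abs c (hsusp [] Y)) ∷ [] ⟩ ⟫
    Sol-T : ∀ {i P P' S S' Γ Γ' σ X r₁ r₂}
      → Pick i P (hvar X ∶ r₁ ∷ [] ≜ r₂ ∷ []) P'
      → ((IsSusp r₁ × IsSusp r₂) ⊎ headE r₁ ≢ headE r₂)
      → Ins (hvar X ∶ r₁ ∷ [] ≜ r₂ ∷ []) S S'
      → Γ' Lists (λ e → e ∈ Γ ⊎
             (∃ λ a → e ≡ (a , hvar X) × a ∈ A × FreshE a r₁ × FreshE a r₂))
      → Step ⟪ P , S , Γ , σ ⟫ (lSolT i) ⟪ P' , S' , Γ' , σ ⟫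
    Sol-H : ∀ {i P P' S S' Γ Γ' σ X s q}
      → Pick i P (hvar X ∶ s ≜ q) P'
      → length (s ++ q) ≡ 1
      → Ins (hvar X ∶ s ≜ q) S S'
      → Γ' Lists (λ e → e ∈ Γ ⊎
             (∃ λ a → e ≡ (a , hvar X) × a ∈ A × FreshH a s × FreshH a q))
      → Step ⟪ P , S , Γ , σ ⟫ (lSolH i) ⟪ P' , S' , Γ' , σ ⟫
    Mer : ∀ {i j P S S' Γ σ χ₁ χ₂ ℓ₁ ℓ₂ r₁ r₂ π}
      → Pick i S (χ₂ ∶ ℓ₂ ≜ r₂) S'
      → (∃ λ R → Pick j S' (χ₁ ∶ ℓ₁ ≜ r₁) R)
      → ((∃ λ x → χ₂ ≡ ivar x) → (∃ λ y → χ₁ ≡ ivar y))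
      → ABased π
      → permH π ℓ₁ ≈H ℓ₂
      → permH π r₁ ≈H r₂
      → Step ⟪ P , S , Γ , σ ⟫ (lMer i j (map (act π) A))
             ⟪ P , S' , renameCtx Γ χ₂ π χ₁ , σ ⟨ χ₂ ↦ suspOf π χ₁ ⟩ ⟫
    Nar-T : ∀ {i P S S' Γ σ X t₁ t₂ x}
      → Pick i S (hvar X ∶ ind t₁ ∷ [] ≜ ind t₂ ∷ []) S'
      → New ∇ ⟪ P , S , Γ , σ ⟫ (ivar x)
      → Step ⟪ P , S , Γ , σ ⟫ (lNarT i)
             ⟪ P , (ivar x ∶ ind t₁ ∷ [] ≜ ind t₂ ∷ []) ∷ S'
             , renameCtx Γ (hvar X) [] (ivar x)
             , σ ⟨ hvar X ↦ ind (isusp [] x) ∷ [] ⟩ ⟫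

mutual
  faT : Term → ℕ
  faT (atom a)    = 0
  faT (isusp π x) = 0
  faT (abs a t)   = suc (faE t)
  faT (fun f s)   = suc (faH s)

  faE : Elem → ℕ
  faE (hsusp π X) = 0
  faE (ind t)     = faT t

  faH : Hedge → ℕ
  faH []      = 0
  faH (r ∷ s) = faE r + faH s

mutual
  hvT : Term → ℕ
  hvT (atom a)    = 0
  hvT (isusp π x) = 0
  hvT (abs a t)   = hvE t
  hvT (fun f s)   = hvH s

  hvE : Elem → ℕ
  hvE (hsusp π X) = 1
  hvE (ind t)     = hvT t

  hvH : Hedge → ℕ
  hvH []      = 0
  hvH (r ∷ s) = hvE r + hvH s

hvV : Var → ℕ
hvV (ivar _) = 0
hvV (hvar _) = 1

sumL : {C : Set} → (C → ℕ) → List C → ℕ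
sumL g []      = 0
sumL g (x ∷ L) = g x + sumL g L

μ₁ μ₂ μ₅ : List AUP → ℕ
μ₁ = sumL (λ { (v ∶ l ≜ r) → faH l + faH r })
μ₂ = sumL sq
  where
  sq : AUP → ℕ
  sq (ivar _ ∶ l ≜ r) = 0
  sq (hvar _ ∶ l ≜ r) = length (l ++ r) * length (l ++ r)
μ₅ = sumL (λ { (v ∶ l ≜ r) → hvV v + hvH l + hvH r })

μ : State → Vec ℕ 5
μ ⟪ P , S , Γ , σ ⟫ =
  μ₁ P V.∷ μ₂ P V.∷ length P V.∷ length S V.∷ μ₅ S V.∷ V.[]

_<lex_ : Vec ℕ 5 → Vec ℕ 5 → Set
_<lex_ = Lex-< _≡_ _<_

-- The measure is additive: μ₁, μ₂ and |P| are sums over the AUPs of P, |S| and μ₅ sums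
-- over those of S, and the lexicographic order on ℕⁿ is invariant under adding a fixed
-- vector. So it suffices that each rule replaces one AUP by locally smaller ones. Tri and
-- Sol delete an AUP from P; Dec-T and Abs-T trade it for one with a symbol fewer on each
-- side; Dec-H keeps the symbols but splits the hedges, and (m + n)² > m² + n² for m, n ≥ 1.
-- Mer deletes an AUP from S, and Nar-T trades a hedge variable for an individual one.
-- There are only finitely many rule applications because each one is determined by its
-- label: positions in P or S, split lengths of at most 1, an atom of A, and the values of an
-- A-based permutation on A, which again lie in A.
module Submission where

open import Defs
open import Data.List using (List)
open import Data.List.Membership.Propositional using (_∈_)
open import Data.Product using (Σ; _×_)

open import Data.Bool using (true; false)
open import Data.Empty using (⊥-elim)
open import Data.List using ([]; _∷_; _++_; length; map; concat; upTo; cartesianProduct; cartesianProductWith)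
open import Data.List.Membership.Propositional.Properties
  using (∈-map⁺; ∈-upTo⁺; ∈-concat⁺′; ∈-cartesianProduct⁺; ∈-cartesianProductWith⁺)
open import Data.List.Properties using (length-++)
open import Data.List.Relation.Unary.Any using (here; there)
open import Data.Nat using (ℕ; zero; suc; _+_; _*_; _<_; _≤_; _≡ᵇ_; z<s; s≤s)
open import Data.Nat.Properties
open import Data.Nat.Tactic.RingSolver using (solve-∀)
open import Algebra.Properties.CommutativeSemigroup +-commutativeSemigroup
  using (interchange; x∙yz≈y∙xz)
open import Data.Product using (_,_; proj₁; proj₂)
open import Data.Sum using (_⊎_; inj₁; inj₂; map₁)
open import Data.Vec using (Vec; _∷_; []; replicate; zipWith) renaming (_++_ to _++ᵥ_)
open import Data.Vec.Relation.Binary.Lex.Core using (this; next)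
open import Data.Vec.Relation.Binary.Lex.Strict using (Lex-<)
import Data.Vec.Relation.Unary.Any as VAny
open import Function using (_∘_)
open import Relation.Binary.PropositionalEquality
  using (_≡_; _≢_; refl; sym; trans; cong; cong₂; subst; subst₂; module ≡-Reasoning)
open import Relation.Nullary using (yes; no)

≡ᵇ-refl : ∀ n → (n ≡ᵇ n) ≡ true
≡ᵇ-refl zero    = refl
≡ᵇ-refl (suc n) = ≡ᵇ-refl n

≢⇒≡ᵇ-false : ∀ {m n} → m ≢ n → (m ≡ᵇ n) ≡ false
≢⇒≡ᵇ-false {m} {n} m≢n with m ≡ᵇ n | ≡ᵇ⇒≡ m n
... | false | _   = refl
... | true  | m≡n = ⊥-elim (m≢n (m≡n _))

swap-fst : ∀ a b → swap (a , b) a ≡ b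
swap-fst a b rewrite ≡ᵇ-refl a = refl

swap-snd : ∀ a b → swap (a , b) b ≡ a
swap-snd a b with b ≟ a
... | yes refl rewrite ≡ᵇ-refl b = refl
... | no b≢a rewrite ≢⇒≡ᵇ-false b≢a | ≡ᵇ-refl b = refl

swap-other : ∀ {a b c} → c ≢ a → c ≢ b → swap (a , b) c ≡ c
swap-other c≢a c≢b rewrite ≢⇒≡ᵇ-false c≢a | ≢⇒≡ᵇ-false c≢b = refl

swap-involutive : ∀ s c → swap s (swap s c) ≡ c
swap-involutive (a , b) c with c ≟ a | c ≟ b
... | yes refl | _        = trans (cong (swap (c , b)) (swap-fst c b)) (swap-snd c b)
... | no _     | yes refl = trans (cong (swap (a , c)) (swap-snd a c)) (swap-fst a c)
... | no c≢a   | no c≢b   rewrite swap-other c≢a c≢b = swap-other c≢a c≢b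

actInv-act : ∀ π c → actInv π (act π c) ≡ c
actInv-act []      c = refl
actInv-act (s ∷ π) c rewrite swap-involutive s (act π c) = actInv-act π c

act-injective : ∀ π {a b} → act π a ≡ act π b → a ≡ b
act-injective π {a} {b} πa≡πb = begin
  a                     ≡⟨ actInv-act π a ⟨
  actInv π (act π a)    ≡⟨ cong (actInv π) πa≡πb ⟩
  actInv π (act π b)    ≡⟨ actInv-act π b ⟩
  b                     ∎
  where open ≡-Reasoning

act-∈-closed : ∀ {A} π → (∀ a → act π a ≢ a → a ∈ A) → ∀ {a} → a ∈ A → act π a ∈ A
act-∈-closed {A} π moved∈A {a} a∈A with act π (act π a) ≟ act π a
... | yes fixed = subst (_∈ A) (sym (act-injective π fixed)) a∈A
... | no  moved = moved∈A (act π a) moved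

Pick-index< : ∀ {C : Set} {i L x R} → Pick {C} i L x R → i < length L
Pick-index< pk-here       = z<s
Pick-index< (pk-there pk) = s≤s (Pick-index< pk)

Pick-length : ∀ {C : Set} {i L x R} → Pick {C} i L x R → length L ≡ suc (length R)
Pick-length pk-here       = refl
Pick-length (pk-there pk) = cong suc (Pick-length pk)

Pick-index∈upTo : ∀ {C : Set} {i L x R} → Pick {C} i L x R → i ∈ upTo (length L)
Pick-index∈upTo pk = ∈-upTo⁺ (Pick-index< pk)

infix 4 _<ₗₑₓ_
infixr 6 _⊕_

_<ₗₑₓ_ : ∀ {n} → Vec ℕ n → Vec ℕ n → Set
_<ₗₑₓ_ = Lex-< _≡_ _<_

_⊕_ : ∀ {n} → Vec ℕ n → Vec ℕ n → Vec ℕ n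
_⊕_ = zipWith _+_

⊕-exchange : ∀ {n} (u v w : Vec ℕ n) → u ⊕ v ⊕ w ≡ v ⊕ u ⊕ w
⊕-exchange []      []      []      = refl
⊕-exchange (x ∷ u) (y ∷ v) (z ∷ w) = cong₂ _∷_ (x∙yz≈y∙xz x y z) (⊕-exchange u v w)

⊕-monoˡ-<ₗₑₓ : ∀ {n} {u v : Vec ℕ n} (w : Vec ℕ n) → u <ₗₑₓ v → u ⊕ w <ₗₑₓ v ⊕ w
⊕-monoˡ-<ₗₑₓ (z ∷ w) (this x<y refl) = this (+-monoˡ-< z x<y) refl
⊕-monoˡ-<ₗₑₓ (z ∷ w) (next refl u<v) = next refl (⊕-monoˡ-<ₗₑₓ w u<v)

<ₗₑₓ-++ : ∀ {m n} {u v : Vec ℕ m} {w w′ : Vec ℕ n} → u <ₗₑₓ v → u ++ᵥ w <ₗₑₓ v ++ᵥ w′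
<ₗₑₓ-++ (this x<y refl) = this x<y refl
<ₗₑₓ-++ (next refl u<v) = next refl (<ₗₑₓ-++ u<v)

++-<ₗₑₓ : ∀ {m n} (u : Vec ℕ m) {w w′ : Vec ℕ n} → w <ₗₑₓ w′ → u ++ᵥ w <ₗₑₓ u ++ᵥ w′
++-<ₗₑₓ []      w<w′ = w<w′
++-<ₗₑₓ (x ∷ u) w<w′ = next refl (++-<ₗₑₓ u w<w′)

replicate-0-<ₗₑₓ : ∀ {n} {u : Vec ℕ n} → VAny.Any (0 <_) u → replicate n 0 <ₗₑₓ u
replicate-0-<ₗₑₓ                (VAny.here 0<x)   = this 0<x refl
replicate-0-<ₗₑₓ {u = zero  ∷ _} (VAny.there 0<u) = next refl (replicate-0-<ₗₑₓ 0<u)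
replicate-0-<ₗₑₓ {u = suc _ ∷ _} (VAny.there _)    = this z<s refl

module AdditiveMeasure {C : Set} {n} (f : List C → Vec ℕ n)
                       (f-++ : ∀ L M → f (L ++ M) ≡ f L ⊕ f M) where

  f-Pick : ∀ {i L x R} → Pick i L x R → f L ≡ f (x ∷ R)
  f-Pick pk-here = refl
  f-Pick (pk-there {i} {x} {y} {L} {R} pk) = begin
    f (y ∷ L)                        ≡⟨ f-++ (y ∷ []) L ⟩
    f (y ∷ []) ⊕ f L                 ≡⟨ cong (f (y ∷ []) ⊕_) (trans (f-Pick pk) (f-++ (x ∷ []) R)) ⟩
    f (y ∷ []) ⊕ f (x ∷ []) ⊕ f R    ≡⟨ ⊕-exchange (f (y ∷ [])) (f (x ∷ [])) (f R) ⟩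
    f (x ∷ []) ⊕ f (y ∷ []) ⊕ f R    ≡⟨ cong (f (x ∷ []) ⊕_) (f-++ (y ∷ []) R) ⟨
    f (x ∷ []) ⊕ f (y ∷ R)           ≡⟨ f-++ (x ∷ []) (y ∷ R) ⟨
    f (x ∷ y ∷ R)                    ∎
    where open ≡-Reasoning

  Pick-replace-<ₗₑₓ : ∀ xs {i L x R} → Pick i L x R → f xs <ₗₑₓ f (x ∷ []) → f (xs ++ R) <ₗₑₓ f L
  Pick-replace-<ₗₑₓ xs {x = x} {R} pk xs<x =
    subst₂ _<ₗₑₓ_ (sym (f-++ xs R)) (trans (sym (f-++ (x ∷ []) R)) (sym (f-Pick pk)))
      (⊕-monoˡ-<ₗₑₓ (f R) xs<x)

sumL-++ : ∀ {C : Set} (g : C → ℕ) L M → sumL g (L ++ M) ≡ sumL g L + sumL g M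
sumL-++ g []      M = refl
sumL-++ g (x ∷ L) M = trans (cong (g x +_) (sumL-++ g L M)) (sym (+-assoc (g x) _ _))

faH-++ : ∀ s q → faH (s ++ q) ≡ faH s + faH q
faH-++ []      q = refl
faH-++ (r ∷ s) q = trans (cong (faE r +_) (faH-++ s q)) (sym (+-assoc (faE r) _ _))

mutual
  faT-perm : ∀ π t → faT (permT π t) ≡ faT t
  faT-perm π (atom a)    = refl
  faT-perm π (isusp _ x) = refl
  faT-perm π (abs a r)   = cong suc (faE-perm π r)
  faT-perm π (fun f s)   = cong suc (faH-perm π s)

  faE-perm : ∀ π r → faE (permE π r) ≡ faE r
  faE-perm π (hsusp _ X) = refl
  faE-perm π (ind t)     = faT-perm π t

  faH-perm : ∀ π s → faH (permH π s) ≡ faH s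
  faH-perm π []      = refl
  faH-perm π (r ∷ s) = cong₂ _+_ (faE-perm π r) (faH-perm π s)

μP : List AUP → Vec ℕ 3
μP P = μ₁ P ∷ μ₂ P ∷ length P ∷ []

μS : List AUP → Vec ℕ 2
μS S = length S ∷ μ₅ S ∷ []

μP-++ : ∀ L M → μP (L ++ M) ≡ μP L ⊕ μP M
μP-++ L M = cong₂ _∷_ (sumL-++ _ L M) (cong₂ _∷_ (sumL-++ _ L M) (cong (_∷ []) (length-++ L)))

μS-++ : ∀ L M → μS (L ++ M) ≡ μS L ⊕ μS M
μS-++ L M = cong₂ _∷_ (length-++ L) (cong (_∷ []) (sumL-++ _ L M))

module μP = AdditiveMeasure μP μP-++
module μS = AdditiveMeasure μS μS-++

μP-delete-<ₗₑₓ : ∀ {i P e R} → Pick i P e R → μP R <ₗₑₓ μP P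
μP-delete-<ₗₑₓ pk =
  μP.Pick-replace-<ₗₑₓ [] pk (replicate-0-<ₗₑₓ (VAny.there (VAny.there (VAny.here z<s))))

μS-delete-<ₗₑₓ : ∀ {i S e R} → Pick i S e R → μS R <ₗₑₓ μS S
μS-delete-<ₗₑₓ pk = μS.Pick-replace-<ₗₑₓ [] pk (this z<s refl)

symbols : AUP → ℕ
symbols (_ ∶ l ≜ r) = faH l + faH r

μP-fewer-symbols-<ₗₑₓ : ∀ e′ e → symbols e′ < symbols e → μP (e′ ∷ []) <ₗₑₓ μP (e ∷ [])
μP-fewer-symbols-<ₗₑₓ e′ e lt = this (+-monoˡ-< 0 lt) refl

square-superadditive : ∀ {m n} → 0 < m → 0 < n → m * m + n * n < (m + n) * (m + n)
square-superadditive {suc a} {suc b} _ _ = begin-strict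
  m * m + n * n                    <⟨ m<n+m (m * m + n * n) z<s ⟩
  2 * (m * n) + (m * m + n * n)    ≡⟨ expand m n ⟩
  (m + n) * (m + n)                ∎
  where
  open ≤-Reasoning
  m = suc a
  n = suc b
  expand : ∀ m n → 2 * (m * n) + (m * m + n * n) ≡ (m + n) * (m + n)
  expand = solve-∀

μP-split-<ₗₑₓ : ∀ X Y₁ Y₂ s₁ s₂ q₁ q₂ → 0 < length (s₁ ++ q₁) → 0 < length (s₂ ++ q₂) →
                μP ((hvar Y₁ ∶ s₁ ≜ q₁) ∷ (hvar Y₂ ∶ s₂ ≜ q₂) ∷ [])
                  <ₗₑₓ μP ((hvar X ∶ s₁ ++ s₂ ≜ q₁ ++ q₂) ∷ [])
μP-split-<ₗₑₓ _ _ _ s₁ s₂ q₁ q₂ 0<n₁ 0<n₂ = next symbols-equal (this squares-smaller refl)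
  where
  symbols-equal : faH s₁ + faH q₁ + (faH s₂ + faH q₂ + 0) ≡ faH (s₁ ++ s₂) + faH (q₁ ++ q₂) + 0
  symbols-equal rewrite faH-++ s₁ s₂ | faH-++ q₁ q₂ | +-identityʳ (faH s₂ + faH q₂) =
    trans (interchange (faH s₁) (faH q₁) (faH s₂) (faH q₂)) (sym (+-identityʳ _))
  n₁ = length (s₁ ++ q₁)
  n₂ = length (s₂ ++ q₂)
  lengths-add : length ((s₁ ++ s₂) ++ (q₁ ++ q₂)) ≡ n₁ + n₂
  lengths-add rewrite length-++ (s₁ ++ s₂) {q₁ ++ q₂} | length-++ s₁ {s₂} | length-++ q₁ {q₂}
                    | length-++ s₁ {q₁} | length-++ s₂ {q₂} =
    interchange (length s₁) (length s₂) (length q₁) (length q₂)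
  squares-smaller : n₁ * n₁ + (n₂ * n₂ + 0)
                    < length ((s₁ ++ s₂) ++ (q₁ ++ q₂)) * length ((s₁ ++ s₂) ++ (q₁ ++ q₂)) + 0
  squares-smaller rewrite lengths-add | +-identityʳ (n₂ * n₂) | +-identityʳ ((n₁ + n₂) * (n₁ + n₂)) =
    square-superadditive 0<n₁ 0<n₂

words : ∀ {C : Set} → List C → ℕ → List (List C)
words A zero    = [] ∷ []
words A (suc n) = cartesianProductWith _∷_ A (words A n)

map-∈-words : ∀ {C D : Set} {A : List D} (f : C → D) (B : List C) →
              (∀ {b} → b ∈ B → f b ∈ A) → map f B ∈ words A (length B)
map-∈-words f []      _   = here refl
map-∈-words f (b ∷ B) f∈A =
  ∈-cartesianProductWith⁺ _∷_ (f∈A (here refl)) (map-∈-words f B (f∈A ∘ there))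

split-nonempty : ∀ {m n} → m + n ≡ 1 ⊎ (m ≡ 1 × n ≡ 1) → 0 < m + n
split-nonempty (inj₁ m+n≡1)      = subst (0 <_) (sym m+n≡1) z<s
split-nonempty (inj₂ (refl , _)) = z<s

split-lengths<2 : ∀ {m n} → m + n ≡ 1 ⊎ (m ≡ 1 × n ≡ 1) → m < 2 × n < 2
split-lengths<2 {m} {n} (inj₁ m+n≡1) =
  s≤s (subst (m ≤_) m+n≡1 (m≤m+n m n)) , s≤s (subst (n ≤_) m+n≡1 (m≤n+m n m))
split-lengths<2 (inj₂ (refl , refl)) = ≤-refl , ≤-refl

split-length-++ : ∀ {C : Set} {Q : Set} (s : List C) {q} →
                  length (s ++ q) ≡ 1 ⊎ Q → length s + length q ≡ 1 ⊎ Q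
split-length-++ s = map₁ (trans (sym (length-++ s)))

labelFamilies : List Atom → State → List (List Label)
labelFamilies A ⟪ P , S , _ , _ ⟫ =
  ( map lTriT inP ∷ map lTriH inP ∷ map lDecT inP ∷ map lSolT inP ∷ map lSolH inP
  ∷ map lNarT inS
  ∷ cartesianProductWith lAbsT inP A
  ∷ cartesianProductWith (λ i (m , n) → lDecH i m n) inP (cartesianProduct (upTo 2) (upTo 2))
  ∷ cartesianProductWith (λ (i , j) → lMer i j) (cartesianProduct inS inS) (words A (length A))
  ∷ [] )
  where
  inP = upTo (length P)
  inS = upTo (length S)

labels : List Atom → State → List Label
labels A st = concat (labelFamilies A st)

module _ (A : List Atom) (∇ : FreshCtx) where
  open VNAU A ∇

  decrease : ∀ {st l st′} → Step st l st′ → μ st′ <lex μ st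
  decrease (Tri-T pk)         = <ₗₑₓ-++ (μP-delete-<ₗₑₓ pk)
  decrease (Tri-H pk)         = <ₗₑₓ-++ (μP-delete-<ₗₑₓ pk)
  decrease (Sol-T pk _ _ _)   = <ₗₑₓ-++ (μP-delete-<ₗₑₓ pk)
  decrease (Sol-H pk _ _ _)   = <ₗₑₓ-++ (μP-delete-<ₗₑₓ pk)
  decrease (Dec-T {X = X} {f} {s} {q} {Y} pk _) =
    <ₗₑₓ-++ (μP.Pick-replace-<ₗₑₓ (new ∷ []) pk (μP-fewer-symbols-<ₗₑₓ new old fewer))
    where
    new = hvar Y ∶ s ≜ q
    old = hvar X ∶ ind (fun f s) ∷ [] ≜ ind (fun f q) ∷ []
    fewer = +-mono-< (s≤s (m≤m+n (faH s) 0)) (s≤s (m≤m+n (faH q) 0))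
  decrease (Abs-T {X = X} {a} {b} {c} {t₁} {t₂} {Y} pk _ _ _ _) =
    <ₗₑₓ-++ (μP.Pick-replace-<ₗₑₓ (new ∷ []) pk (μP-fewer-symbols-<ₗₑₓ new old fewer))
    where
    new = hvar Y ∶ permH ((c , a) ∷ []) (t₁ ∷ []) ≜ permH ((c , b) ∷ []) (t₂ ∷ [])
    old = hvar X ∶ ind (abs a t₁) ∷ [] ≜ ind (abs b t₂) ∷ []
    fewer = +-mono-< (s≤s (≤-reflexive (faH-perm ((c , a) ∷ []) (t₁ ∷ []))))
                     (s≤s (≤-reflexive (faH-perm ((c , b) ∷ []) (t₂ ∷ []))))
  decrease (Dec-H {X = X} {s₁} {s₂} {q₁} {q₂} {Y₁} {Y₂} pk split second-nonempty _ _ _) =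
    <ₗₑₓ-++ (μP.Pick-replace-<ₗₑₓ ((hvar Y₁ ∶ s₁ ≜ q₁) ∷ (hvar Y₂ ∶ s₂ ≜ q₂) ∷ []) pk
      (μP-split-<ₗₑₓ X Y₁ Y₂ s₁ s₂ q₁ q₂ first-nonempty second-nonempty))
    where
    first-nonempty = subst (0 <_) (sym (length-++ s₁)) (split-nonempty (split-length-++ s₁ split))
  decrease (Mer {P = P} pk _ _ _ _ _) = ++-<ₗₑₓ (μP P) (μS-delete-<ₗₑₓ pk)
  decrease (Nar-T {P = P} {t₁ = t₁} {t₂} {x} pk _) =
    ++-<ₗₑₓ (μP P) (μS.Pick-replace-<ₗₑₓ ((ivar x ∶ ind t₁ ∷ [] ≜ ind t₂ ∷ []) ∷ []) pk
      (next refl (this (n<1+n _) refl)))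

  ∈-labels : ∀ {l L} st → L ∈ labelFamilies A st → l ∈ L → l ∈ labels A st
  ∈-labels st L∈families l∈L = ∈-concat⁺′ l∈L L∈families

  step-label∈labels : ∀ {st l st′} → Step st l st′ → l ∈ labels A st
  step-label∈labels {st} (Tri-T pk) =
    ∈-labels st (here refl) (∈-map⁺ lTriT (Pick-index∈upTo pk))
  step-label∈labels {st} (Tri-H pk) =
    ∈-labels st (there (here refl)) (∈-map⁺ lTriH (Pick-index∈upTo pk))
  step-label∈labels {st} (Dec-T pk _) =
    ∈-labels st (there (there (here refl))) (∈-map⁺ lDecT (Pick-index∈upTo pk))
  step-label∈labels {st} (Sol-T pk _ _ _) =
    ∈-labels st (there (there (there (here refl)))) (∈-map⁺ lSolT (Pick-index∈upTo pk))
  step-label∈labels {st} (Sol-H pk _ _ _) =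
    ∈-labels st (there (there (there (there (here refl))))) (∈-map⁺ lSolH (Pick-index∈upTo pk))
  step-label∈labels {st} (Nar-T pk _) =
    ∈-labels st (there (there (there (there (there (here refl))))))
      (∈-map⁺ lNarT (Pick-index∈upTo pk))
  step-label∈labels {st} (Abs-T pk c∈A _ _ _) =
    ∈-labels st (there (there (there (there (there (there (here refl)))))))
      (∈-cartesianProductWith⁺ lAbsT (Pick-index∈upTo pk) c∈A)
  step-label∈labels {st} (Dec-H {s₁ = s₁} pk split _ _ _ _) =
    ∈-labels st (there (there (there (there (there (there (there (here refl))))))))
      (∈-cartesianProductWith⁺ _ (Pick-index∈upTo pk)
        (∈-cartesianProduct⁺ (∈-upTo⁺ (proj₁ short)) (∈-upTo⁺ (proj₂ short))))
    where
    short = split-lengths<2 (split-length-++ s₁ split)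
  step-label∈labels {st} (Mer {π = π} pk (_ , pk₂) _ π-A _ _) =
    ∈-labels st (there (there (there (there (there (there (there (there (here refl)))))))))
      (∈-cartesianProductWith⁺ _ (∈-cartesianProduct⁺ (Pick-index∈upTo pk) j∈upTo)
        (map-∈-words (act π) A (act-∈-closed π π-A)))
    where
    j∈upTo = ∈-upTo⁺ (subst (_ <_) (sym (Pick-length pk)) (m<n⇒m<1+n (Pick-index< pk₂)))

theorem1 : (A : List Atom) (∇ : FreshCtx) (st : State) →
    let open VNAU A ∇ in
      (Σ (List Label) λ L → ∀ {l st'} → Step st l st' → l ∈ L)
      × (∀ {l st'} → Step st l st' → μ st' <lex μ st)
theorem1 A ∇ st = (labels A st , step-label∈labels A ∇) , decrease A ∇
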